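{- Let $G$ be a finite abelian group and let $p$ be a prime. Then $G$ satisfies property $\mathcal P(p)$ if and only if the (unique) $p$-Sylow subgroup of $G$ is not homocyclic.
   Context: For $\ell\ge1$ and $x\in G$, $r_\ell(x)=|\{g\in G:g^\ell=x\}|$. $G$ satisfies $\mathcal P(p)$ if there exist $a,b\in G$ of the same order with $0=r_p(a)<r_p(b)$ and $r_\ell(a)=r_\ell(b)$ for every square-free integer $1<\ell<p$. A homocyclic $p$-group is a direct product of cyclic $p$-groups all of the same order. -}

module Defs where

open import Level using (Level; _⊔_)
open import Algebra.Bundles using (AbelianGroup)
open import Data.Nat using (ℕ; zero; suc; _<_; _*_; _^_)
open import Data.Nat.Divisibility using (_∣_)
open import Data.Fin using (Fin)
import Data.Fin as Fin
open import Data.List using (List; length; filter; allFin)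
open import Data.Product using (Σ; ∃; _×_; _,_)
open import Relation.Nullary using (¬_; Dec)
open import Relation.Binary.PropositionalEquality using (_≡_)

SquareFree : ℕ → Set
SquareFree ℓ = ∀ m → m * m ∣ ℓ → m ≡ 1

record IsFinite {c ℓ : Level} (G : AbelianGroup c ℓ) : Set (c ⊔ ℓ) where
  open AbelianGroup G
  field
    size      : ℕ
    enum      : Fin size → Carrier
    enum-surj : ∀ x → ∃ λ i → enum i ≈ x
    enum-inj  : ∀ i j → enum i ≈ enum j → i ≡ j
    _≈?_      : ∀ x y → Dec (x ≈ y)

module _ {c ℓ' : Level} (G : AbelianGroup c ℓ') where
  open AbelianGroup G

  pow : Carrier → ℕ → Carrier
  pow g zero    = ε
  pow g (suc n) = g ∙ pow g n

  HasOrder : Carrier → ℕ → Set ℓ'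
  HasOrder g k = (0 < k) × (pow g k ≈ ε) × (∀ j → 0 < j → j < k → ¬ (pow g j ≈ ε))

  SameOrder : Carrier → Carrier → Set ℓ'
  SameOrder a b = ∃ λ k → HasOrder a k × HasOrder b k

  prodFin : ∀ r → (Fin r → Carrier) → Carrier
  prodFin zero    f = ε
  prodFin (suc r) f = f Fin.zero ∙ prodFin r (λ i → f (Fin.suc i))

  InSylow : ℕ → Carrier → Set ℓ'
  InSylow p x = ∃ λ m → pow x (p ^ m) ≈ ε

  -- The p-Sylow subgroup is homocyclic: it is the internal direct product
  -- of r cyclic subgroups ⟨g_i⟩, each g_i of the same order p^e.
  SylowHomocyclic : ℕ → Set (c ⊔ ℓ')
  SylowHomocyclic p =
    Σ ℕ λ e → Σ ℕ λ r → Σ (Fin r → Carrier) λ g →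
      (∀ i → HasOrder (g i) (p ^ e))
      × (∀ x → InSylow p x →
           Σ (Fin r → Fin (p ^ e)) λ cs → prodFin r (λ i → pow (g i) (Fin.toℕ (cs i))) ≈ x)
      × (∀ (cs ds : Fin r → Fin (p ^ e)) →
           prodFin r (λ i → pow (g i) (Fin.toℕ (cs i)))
             ≈ prodFin r (λ i → pow (g i) (Fin.toℕ (ds i))) →
           ∀ i → cs i ≡ ds i)

module _ {c ℓ' : Level} (G : AbelianGroup c ℓ') (F : IsFinite G) where
  open AbelianGroup G
  open IsFinite F

  roots : ℕ → Carrier → ℕ
  roots l x = length (filter (λ i → pow G (enum i) l ≈? x) (allFin size))

  PropertyP : ℕ → Set (c ⊔ ℓ')
  PropertyP p = Σ Carrier λ a → Σ Carrier λ b →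
      SameOrder G a b
      × roots p a ≡ 0
      × 0 < roots p b
      × (∀ l → 1 < l → l < p → SquareFree l → roots l a ≡ roots l b)

-- Let S be the p-Sylow subgroup.  If S is homocyclic of exponent p ^ e, its elements killed by
-- p ^ (e - 1) are p-th powers.  Given a and b = c ^ p of common order p ^ k * m with p ∤ m, the element
-- c ^ m has order p ^ (k + 1), so k < e; hence a ^ m, and with it a, is a p-th power, contradicting
-- r_p(a) = 0.
-- Conversely, let S have exponent p ^ (e + 1).  If every element killed by p ^ e is a p-th power, an
-- independent family of elements of order p ^ (e + 1) can always be extended by an element outside its
-- span, so greedily a basis of S is reached and S is homocyclic.  Otherwise some a with a ^ (p ^ e) = ε
-- is not a p-th power; its order p ^ j is also that of the p-th power b = g ^ (p ^ (e + 1 - j)), where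
-- g has order p ^ (e + 1).  For ℓ < p, elements of p-power order are ℓ-th powers, and every ℓ-th power
-- has exactly r_ℓ(ε) ℓ-th roots, so r_ℓ(a) = r_ℓ(b).

module Submission where

open import Defs
open import Level using (Level; _⊔_)
open import Algebra.Bundles using (AbelianGroup)
open import Data.Bool using (Bool; true; false; if_then_else_)
open import Data.Fin using (Fin; toℕ)
import Data.Fin as Fin
import Data.Fin.Properties as Fin
open import Data.Fin.Permutation using (Permutation′; permutation; _⟨$⟩ʳ_)
open import Data.List using ([]; _∷_; length; filter; tabulate; allFin)
open import Data.List.Properties using (filter-some; filter-none; length-filter; length-tabulate)
open import Data.List.Relation.Unary.Any using (Any; here; there)
import Data.List.Relation.Unary.Any.Properties as Any
import Data.List.Relation.Unary.All.Properties as All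
open import Data.Nat
  using (ℕ; zero; suc; _+_; _*_; _∸_; _^_; _<_; _≤_; _≟_; _≤?_; _<?_; z≤n; s≤s; z<s; s<s; NonZero)
open import Data.Nat.Base using (nonTrivial⇒n>1; >-nonZero; >-nonZero⁻¹)
open import Data.Nat.Properties
open import Algebra.Properties.CommutativeMonoid.Sum +-0-commutativeMonoid as ℕSum using (sum-syntax)
open import Data.Nat.Coprimality using (Coprime; coprime-divisor; coprime-Bézout; prime⇒coprime)
import Data.Nat.Coprimality as Coprime
open import Data.Nat.Divisibility
  using (_∣_; divides; _∣?_; ∣1⇒≡1; ∣-trans; n∣m*n; m∣m*n; *-cancelʳ-∣; m%n≡0⇒n∣m; n∣m⇒m%n≡0)
open import Data.Nat.DivMod using (_%_; _/_; _mod_; m≡m%n+[m/n]*n; m%n<n; m/n*n≡m)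
open import Data.Nat.GCD using (module Bézout)
open import Data.Nat.Induction using (<-rec)
open import Data.Nat.Primality using (Prime; prime⇒nonZero; prime⇒nonTrivial; prime⇒irreducible)
open import Data.Nat.Tactic.RingSolver using (solve-∀)
open import Data.Product using (∃; ∃₂; _×_; _,_; proj₁; proj₂)
open import Data.Sum using (_⊎_; inj₁; inj₂)
open import Data.Vec.Functional using (head; tail) renaming (_∷_ to cons)
open import Function.Bundles using (_⇔_; mk⇔)
open import Relation.Binary using (_Respects_; tri<; tri≈; tri>)
open import Relation.Binary.PropositionalEquality as ≡ using (_≡_; refl)
open import Relation.Nullary using (¬_; Dec; yes; no; contradiction)
open import Relation.Nullary.Decidable using (does; does-⇔; _→-dec_)
import Relation.Nullary.Decidable as Dec
open import Relation.Unary using (Pred; Decidable; _⊆_)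

-- Arithmetic

^-monoʳ-∣ : ∀ m {j k} → j ≤ k → m ^ j ∣ m ^ k
^-monoʳ-∣ m {j} {k} j≤k = divides (m ^ (k ∸ j))
  (≡.trans (≡.cong (m ^_) (≡.sym (m∸n+n≡m j≤k))) (^-distribˡ-+-* m (k ∸ j) j))

n<m^n : ∀ {m} → 1 < m → ∀ n → n < m ^ n
n<m^n 1<m zero = z<s
n<m^n {m} 1<m (suc n) = begin-strict
  suc n         ≤⟨ n<m^n 1<m n ⟩
  m ^ n         <⟨ m<m*n (m ^ n) m {{m^n≢0 m n}} 1<m ⟩
  m ^ n * m     ≡⟨ *-comm (m ^ n) m ⟩
  m * m ^ n     ∎
  where
  open ≤-Reasoning
  instance
    m-nonZero : NonZero m
    m-nonZero = >-nonZero (<-trans z<s 1<m)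

^-split : ∀ m {s e} u → s ≤ e → m ^ s * u * m ^ (e ∸ s) ≡ u * m ^ e
^-split m {s} {e} u s≤e = begin
  m ^ s * u * m ^ (e ∸ s)     ≡⟨ shuffle (m ^ s) u (m ^ (e ∸ s)) ⟩
  u * (m ^ s * m ^ (e ∸ s))   ≡⟨ ≡.cong (u *_) (^-distribˡ-+-* m s (e ∸ s)) ⟨
  u * m ^ (s + (e ∸ s))       ≡⟨ ≡.cong (λ k → u * m ^ k) (m+[n∸m]≡n s≤e) ⟩
  u * m ^ e                   ∎
  where
  open ≡.≡-Reasoning
  shuffle : ∀ a u b → a * u * b ≡ u * (a * b)
  shuffle = solve-∀

mod≡0⇒∣ : ∀ n q .{{_ : NonZero q}} → n mod q ≡ 0 mod q → q ∣ n
mod≡0⇒∣ n q n≡0 = m%n≡0⇒n∣m n q (begin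
  n % q           ≡⟨ Fin.toℕ-fromℕ< _ ⟨
  toℕ (n mod q)   ≡⟨ ≡.cong toℕ n≡0 ⟩
  toℕ (0 mod q)   ≡⟨ Fin.toℕ-fromℕ< _ ⟩
  0 % q           ≡⟨ n∣m⇒m%n≡0 0 q (divides 0 refl) ⟩
  0               ∎)
  where open ≡.≡-Reasoning

coprime-^ʳ : ∀ {m n} → Coprime m n → ∀ k → Coprime m (n ^ k)
coprime-^ʳ m⊥n zero (_ , d∣1) = ∣1⇒≡1 d∣1
coprime-^ʳ {m} {n} m⊥n (suc k) {d} (d∣m , d∣n^sk) =
  coprime-^ʳ m⊥n k (d∣m , coprime-divisor d⊥n d∣n^sk)
  where
  d⊥n : Coprime d n
  d⊥n (c∣d , c∣n) = m⊥n (∣-trans c∣d d∣m , c∣n)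

least : ∀ {b} {P : ℕ → Set b} → (∀ n → Dec (P n)) →
        ∀ {N} → P N → ∃ λ k → P k × k ≤ N × (∀ {j} → j < k → ¬ P j)
least P? {N} pN with P? 0
... | yes p0 = 0 , p0 , z≤n , λ ()
least P? {zero} pN | no ¬p0 = contradiction pN ¬p0
least P? {suc N} pN | no ¬p0 with least (λ n → P? (suc n)) pN
... | k , pk , k≤N , below = suc k , pk , s≤s k≤N , λ { {zero} _ → ¬p0 ; {suc j} (s<s j<k) → below j<k }

crossing : ∀ {b} {P : ℕ → Set b} → (∀ n → Dec (P n)) →
           ¬ P 0 → ∀ {N} → P N → ∃ λ k → ¬ P k × P (suc k)
crossing P? ¬p0 {zero} pN = contradiction pN ¬p0
crossing P? ¬p0 {suc N} pN with P? N
... | yes pN′ = crossing P? ¬p0 pN′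
... | no ¬pN′ = N , ¬pN′ , pN

module PrimePowers {p : ℕ} (p-prime : Prime p) where

  instance
    p-nonZero : NonZero p
    p-nonZero = prime⇒nonZero p-prime

  p^-nonZero : ∀ k → NonZero (p ^ k)
  p^-nonZero k = m^n≢0 p k

  1<p : 1 < p
  1<p = nonTrivial⇒n>1 p {{prime⇒nonTrivial p-prime}}

  ∤⇒coprime : ∀ {m} → ¬ p ∣ m → Coprime m p
  ∤⇒coprime p∤m {d} (d∣m , d∣p) with prime⇒irreducible p-prime d∣p
  ... | inj₁ d≡1 = d≡1
  ... | inj₂ refl = contradiction d∣m p∤m

  p-part : ∀ n → 0 < n → ∃₂ λ k m → n ≡ p ^ k * m × ¬ p ∣ m
  p-part = <-rec (λ n → 0 < n → Split n) split
    where
    Split : ℕ → Set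
    Split n = ∃₂ λ k m → n ≡ p ^ k * m × ¬ p ∣ m

    times-p : ∀ {q} → Split q → Split (q * p)
    times-p (k , m , refl , p∤m) = suc k , m , rearrange (p ^ k) m p , p∤m
      where
      rearrange : ∀ a m p → a * m * p ≡ p * a * m
      rearrange = solve-∀

    split : ∀ n → (∀ {n′} → n′ < n → 0 < n′ → Split n′) → 0 < n → Split n
    split n rec 0<n with p ∣? n
    ... | no p∤n = 0 , n , ≡.sym (*-identityˡ n) , p∤n
    ... | yes (divides q refl) = times-p (rec (m<m*n q p 1<p) (>-nonZero⁻¹ q))
      where
      instance
        q-nonZero : NonZero q
        q-nonZero = m*n≢0⇒m≢0 q {{>-nonZero 0<n}}

  exponent-bound : ∀ {s e u} → 0 < p ^ s * u → p ^ s * u < p ^ suc e → s ≤ e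
  exponent-bound {s} {e} {u} 0<δ δ<pᵉ⁺¹ with s ≤? e
  ... | yes s≤e = s≤e
  ... | no s≰e = contradiction δ<pᵉ⁺¹ (≤⇒≯ (begin
    p ^ suc e    ≤⟨ ^-monoʳ-≤ p (≰⇒> s≰e) ⟩
    p ^ s        ≤⟨ m≤m*n (p ^ s) u {{m*n≢0⇒n≢0 (p ^ s) {{>-nonZero 0<δ}}}} ⟩
    p ^ s * u    ∎))
    where open ≤-Reasoning

  ∣p^⇒≡p^ : ∀ {d} m → d ∣ p ^ m → ∃ λ j → j ≤ m × d ≡ p ^ j
  ∣p^⇒≡p^ zero d∣1 = 0 , z≤n , ∣1⇒≡1 d∣1
  ∣p^⇒≡p^ {d} (suc m) d∣p^sm with p ∣? d
  ... | no p∤d with ∣p^⇒≡p^ m (coprime-divisor (∤⇒coprime p∤d) d∣p^sm)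
  ...   | j , j≤m , d≡p^j = j , m≤n⇒m≤1+n j≤m , d≡p^j
  ∣p^⇒≡p^ {d} (suc m) d∣p^sm | yes (divides q refl)
    with ∣p^⇒≡p^ {q} m (*-cancelʳ-∣ p (≡.subst (q * p ∣_) (*-comm p (p ^ m)) d∣p^sm))
  ... | j , j≤m , refl = suc j , s≤s j≤m , *-comm (p ^ j) p

  p^suc∣⇒p∣ : ∀ e c → p ^ suc e ∣ c * p ^ e → p ∣ c
  p^suc∣⇒p∣ e c (divides t eq) =
    divides t (*-cancelʳ-≡ c (t * p) (p ^ e) {{p^-nonZero e}} (≡.trans eq (≡.sym (*-assoc t p (p ^ e)))))

-- Counting

module _ {a p q} {A : Set a} {P : Pred A p} {Q : Pred A q} (P? : Decidable P) (Q? : Decidable Q)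
         (P⊆Q : P ⊆ Q) where

  filter-length-mono : ∀ xs → length (filter P? xs) ≤ length (filter Q? xs)
  filter-length-mono [] = z≤n
  filter-length-mono (x ∷ xs) with P? x | Q? x
  ... | yes _  | yes _   = s≤s (filter-length-mono xs)
  ... | yes px | no ¬qx  = contradiction (P⊆Q px) ¬qx
  ... | no _   | yes _   = m≤n⇒m≤1+n (filter-length-mono xs)
  ... | no _   | no _    = filter-length-mono xs

  filter-length-strictMono : ∀ {xs} → Any (λ x → Q x × ¬ P x) xs →
                             length (filter P? xs) < length (filter Q? xs)
  filter-length-strictMono {x ∷ xs} (here (qx , ¬px)) with P? x | Q? x
  ... | yes px | _      = contradiction px ¬px
  ... | no _   | yes _  = s≤s (filter-length-mono xs)
  ... | no _   | no ¬qx = contradiction qx ¬qx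
  filter-length-strictMono {x ∷ xs} (there w) with P? x | Q? x
  ... | yes _  | yes _  = s≤s (filter-length-strictMono w)
  ... | yes px | no ¬qx = contradiction (P⊆Q px) ¬qx
  ... | no _   | yes _  = m≤n⇒m≤1+n (filter-length-strictMono w)
  ... | no _   | no _   = filter-length-strictMono w

indicator : Bool → ℕ
indicator b = if b then 1 else 0

module _ {n p} {P : Pred (Fin n) p} (P? : Decidable P) where

  count : ℕ
  count = length (filter P? (allFin n))

  count>0 : ∀ {i} → P i → 0 < count
  count>0 {i} Pi = filter-some P? (Any.tabulate⁺ i Pi)

  count≡0 : (∀ i → ¬ P i) → count ≡ 0
  count≡0 ¬P = ≡.cong length (filter-none P? (All.tabulate⁺ ¬P))

  count>0⇒∃ : 0 < count → ∃ P
  count>0⇒∃ 0<count with Fin.any? P?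
  ... | yes ∃P = ∃P
  ... | no ¬∃P = contradiction (count≡0 λ i Pi → ¬∃P (i , Pi)) (>⇒≢ 0<count)

  count≤n : count ≤ n
  count≤n = ≤-trans (length-filter P? (allFin n)) (≤-reflexive (length-tabulate (λ i → i)))

  count≡sum : count ≡ ∑[ i < n ] indicator (does (P? i))
  count≡sum = go (λ i → i)
    where
    go : ∀ {m} (f : Fin m → Fin n) → length (filter P? (tabulate f)) ≡ ∑[ i < m ] indicator (does (P? (f i)))
    go {zero} f = refl
    go {suc m} f with does (P? (f Fin.zero))
    ... | true  = ≡.cong suc (go (λ i → f (Fin.suc i)))
    ... | false = go (λ i → f (Fin.suc i))

count-strictMono : ∀ {n p q} {P : Pred (Fin n) p} {Q : Pred (Fin n) q} (P? : Decidable P) (Q? : Decidable Q) →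
                   P ⊆ Q → ∀ {i} → Q i → ¬ P i → count P? < count Q?
count-strictMono P? Q? P⊆Q {i} Qi ¬Pi = filter-length-strictMono P? Q? P⊆Q (Any.tabulate⁺ i (Qi , ¬Pi))

count-permute : ∀ {n p q} {P : Pred (Fin n) p} {Q : Pred (Fin n) q} (P? : Decidable P) (Q? : Decidable Q) →
                (π : Permutation′ n) → (∀ i → P i ⇔ Q (π ⟨$⟩ʳ i)) → count P? ≡ count Q?
count-permute P? Q? π P⇔Q∘π = begin
  count P?                                     ≡⟨ count≡sum P? ⟩
  ∑[ i < _ ] indicator (does (P? i))           ≡⟨ ℕSum.sum-cong-≗ (λ i → ≡.cong indicator (same-does i)) ⟩
  ∑[ i < _ ] indicator (does (Q? (π ⟨$⟩ʳ i)))  ≡⟨ ℕSum.sum-permute _ π ⟨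
  ∑[ i < _ ] indicator (does (Q? i))           ≡⟨ count≡sum Q? ⟨
  count Q?                                     ∎
  where
  open ≡.≡-Reasoning
  same-does : ∀ i → does (P? i) ≡ does (Q? (π ⟨$⟩ʳ i))
  same-does i = does-⇔ (P⇔Q∘π i) (P? i) (Q? _)

∃-Fin→? : ∀ {p} r q {P : (Fin r → Fin q) → Set p} →
          (∀ {cs ds} → (∀ i → cs i ≡ ds i) → P cs → P ds) → (∀ cs → Dec (P cs)) → Dec (∃ P)
∃-Fin→? zero q resp P? with P? (λ ())
... | yes P[] = yes (_ , P[])
... | no ¬P[] = no λ (cs , Pcs) → ¬P[] (resp (λ ()) Pcs)
∃-Fin→? (suc r) q resp P? = Dec.map′
  (λ (c , cs , Pc∷cs) → cons c cs , Pc∷cs)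
  (λ (cs , Pcs) → head cs , tail cs , resp (λ { Fin.zero → refl ; (Fin.suc i) → refl }) Pcs)
  (Fin.any? λ c → ∃-Fin→? r q (λ eq → resp λ { Fin.zero → refl ; (Fin.suc i) → eq i }) (λ cs → P? (cons c cs)))

module Powers {c ℓ : Level} (G : AbelianGroup c ℓ) where

  open AbelianGroup G renaming (refl to ≈-refl)
  open import Relation.Binary.Reasoning.Setoid setoid
  open import Algebra.Properties.CommutativeMonoid.Mult commutativeMonoid as Mult using () renaming (_×_ to _·_)
  open import Algebra.Properties.CommutativeMonoid.Sum commutativeMonoid as Sum using (sum)
  open import Algebra.Properties.Group group using (inverseʳ-unique; x≈z//y; ∙-cancelˡ)

  infixr 8 _↑_

  _↑_ : Carrier → ℕ → Carrier
  x ↑ n = pow G x n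

  ↑≡× : ∀ x n → x ↑ n ≡ n · x
  ↑≡× x zero = refl
  ↑≡× x (suc n) = ≡.cong (x ∙_) (↑≡× x n)

  ↑-congˡ : ∀ {x y} n → x ≈ y → x ↑ n ≈ y ↑ n
  ↑-congˡ {x} {y} n x≈y rewrite ↑≡× x n | ↑≡× y n = Mult.×-congʳ n x≈y

  ↑-homo-+ : ∀ x m n → x ↑ (m + n) ≈ x ↑ m ∙ x ↑ n
  ↑-homo-+ x m n rewrite ↑≡× x (m + n) | ↑≡× x m | ↑≡× x n = Mult.×-homo-+ x m n

  ↑-assoc : ∀ x m n → x ↑ (m * n) ≈ (x ↑ m) ↑ n
  ↑-assoc x m n rewrite ↑≡× x (m * n) | ↑≡× (x ↑ m) n | ↑≡× x m | *-comm m n =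
    sym (Mult.×-assocˡ x n m)

  ↑-distrib-∙ : ∀ x y n → (x ∙ y) ↑ n ≈ x ↑ n ∙ y ↑ n
  ↑-distrib-∙ x y n rewrite ↑≡× (x ∙ y) n | ↑≡× x n | ↑≡× y n = Mult.×-distrib-+ x y n

  ↑-comm : ∀ x m n → x ↑ (m * n) ≈ (x ↑ n) ↑ m
  ↑-comm x m n = trans (reflexive (≡.cong (x ↑_) (*-comm m n))) (↑-assoc x n m)

  ↑-identity : ∀ x → x ↑ 1 ≈ x
  ↑-identity = identityʳ

  order-ann : ∀ {g k} → HasOrder G g k → g ↑ k ≈ ε
  order-ann (_ , gᵏ≈ε , _) = gᵏ≈ε

  ε↑ : ∀ n → ε ↑ n ≈ ε
  ε↑ zero = ≈-refl
  ε↑ (suc n) = trans (identityˡ _) (ε↑ n)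

  ⁻¹-↑ : ∀ x n → (x ⁻¹) ↑ n ≈ (x ↑ n) ⁻¹
  ⁻¹-↑ x n = inverseʳ-unique (x ↑ n) ((x ⁻¹) ↑ n) (begin
    x ↑ n ∙ (x ⁻¹) ↑ n ≈⟨ ↑-distrib-∙ x (x ⁻¹) n ⟨
    (x ∙ x ⁻¹) ↑ n    ≈⟨ ↑-congˡ n (inverseʳ x) ⟩
    ε ↑ n             ≈⟨ ε↑ n ⟩
    ε                 ∎)

  ↑-annihilates-multiple : ∀ x {k} n → k ∣ n → x ↑ k ≈ ε → x ↑ n ≈ ε
  ↑-annihilates-multiple x {k} _ (divides t refl) xᵏ≈ε = begin
    x ↑ (t * k)    ≈⟨ ↑-comm x t k ⟩
    (x ↑ k) ↑ t    ≈⟨ ↑-congˡ t xᵏ≈ε ⟩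
    ε ↑ t          ≈⟨ ε↑ t ⟩
    ε              ∎

  annihilated-↑ : ∀ x k {n} → x ↑ n ≈ ε → (x ↑ k) ↑ n ≈ ε
  annihilated-↑ x k {n} xⁿ≈ε = trans (sym (↑-assoc x k n)) (↑-annihilates-multiple x (k * n) (n∣m*n k) xⁿ≈ε)

  annihilated-resp : ∀ n → (λ x → x ↑ n ≈ ε) Respects _≈_
  annihilated-resp n x≈y xⁿ≈ε = trans (↑-congˡ n (sym x≈y)) xⁿ≈ε

  ↑-mod : ∀ x k n .{{_ : NonZero k}} → x ↑ k ≈ ε → x ↑ n ≈ x ↑ (n % k)
  ↑-mod x k n xᵏ≈ε = begin
    x ↑ n                          ≡⟨ ≡.cong (x ↑_) (m≡m%n+[m/n]*n n k) ⟩
    x ↑ (n % k + n / k * k)        ≈⟨ ↑-homo-+ x (n % k) (n / k * k) ⟩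
    x ↑ (n % k) ∙ x ↑ (n / k * k)  ≈⟨ ∙-congˡ (↑-annihilates-multiple x _ (n∣m*n (n / k)) xᵏ≈ε) ⟩
    x ↑ (n % k) ∙ ε                ≈⟨ identityʳ _ ⟩
    x ↑ (n % k)                    ∎

  prodFin≡sum : ∀ r (f : Fin r → Carrier) → prodFin G r f ≡ sum f
  prodFin≡sum zero f = refl
  prodFin≡sum (suc r) f = ≡.cong (f Fin.zero ∙_) (prodFin≡sum r (λ i → f (Fin.suc i)))

  prodFin-cong : ∀ r {f g : Fin r → Carrier} → (∀ i → f i ≈ g i) → prodFin G r f ≈ prodFin G r g
  prodFin-cong r {f} {g} f≈g rewrite prodFin≡sum r f | prodFin≡sum r g = Sum.sum-cong-≋ f≈g

  prodFin-∙ : ∀ r (f g : Fin r → Carrier) →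
              prodFin G r (λ i → f i ∙ g i) ≈ prodFin G r f ∙ prodFin G r g
  prodFin-∙ r f g rewrite prodFin≡sum r (λ i → f i ∙ g i) | prodFin≡sum r f | prodFin≡sum r g =
    Sum.∑-distrib-+ f g

  prodFin-ε : ∀ r {f : Fin r → Carrier} → (∀ i → f i ≈ ε) → prodFin G r f ≈ ε
  prodFin-ε r {f} f≈ε rewrite prodFin≡sum r f = trans (Sum.sum-cong-≋ f≈ε) (Sum.sum-replicate-zero r)

  prodFin-↑ : ∀ r (f : Fin r → Carrier) n → prodFin G r f ↑ n ≈ prodFin G r (λ i → f i ↑ n)
  prodFin-↑ zero f n = ε↑ n
  prodFin-↑ (suc r) f n = trans (↑-distrib-∙ _ _ n) (∙-congˡ (prodFin-↑ r (λ i → f (Fin.suc i)) n))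

  record IsSubgroup {s} (S : Carrier → Set s) : Set (c ⊔ ℓ ⊔ s) where
    field
      resp     : ∀ {x y} → x ≈ y → S x → S y
      ε∈       : S ε
      ∙-closed : ∀ {x y} → S x → S y → S (x ∙ y)
      ⁻¹-closed : ∀ {x} → S x → S (x ⁻¹)

    ↑-closed : ∀ {x} n → S x → S (x ↑ n)
    ↑-closed zero    _  = ε∈
    ↑-closed (suc n) Sx = ∙-closed Sx (↑-closed n Sx)

    //-closed : ∀ {x y} → S x → S y → S (x ∙ y ⁻¹)
    //-closed Sx Sy = ∙-closed Sx (⁻¹-closed Sy)

    solve-∙ : ∀ {x s t} → x ∙ s ≈ t → S s → S t → S x
    solve-∙ {x} {s} {t} xs≈t Ss St = resp (sym (x≈z//y x s t xs≈t)) (//-closed St Ss)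

  coprime-powers-generate : ∀ {s} {S : Carrier → Set s} → IsSubgroup S →
                            ∀ {m n} → Coprime m n → ∀ {a} → S (a ↑ m) → S (a ↑ n) → S a
  coprime-powers-generate S-sub {m} {n} m⊥n {a} Saᵐ Saⁿ with coprime-Bézout m⊥n
  ... | Bézout.+- x y 1+yn≡xm = solve-∙ (begin
    a ∙ (a ↑ n) ↑ y     ≈⟨ ∙-congˡ (↑-comm a y n) ⟨
    a ↑ (1 + y * n)     ≡⟨ ≡.cong (a ↑_) 1+yn≡xm ⟩
    a ↑ (x * m)         ≈⟨ ↑-comm a x m ⟩
    (a ↑ m) ↑ x         ∎) (↑-closed y Saⁿ) (↑-closed x Saᵐ)
    where open IsSubgroup S-sub
  ... | Bézout.-+ x y 1+xm≡yn = solve-∙ (begin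
    a ∙ (a ↑ m) ↑ x     ≈⟨ ∙-congˡ (↑-comm a x m) ⟨
    a ↑ (1 + x * m)     ≡⟨ ≡.cong (a ↑_) 1+xm≡yn ⟩
    a ↑ (y * n)         ≈⟨ ↑-comm a y n ⟩
    (a ↑ n) ↑ y         ∎) (↑-closed x Saᵐ) (↑-closed y Saⁿ)
    where open IsSubgroup S-sub

  HasRoot : ℕ → Carrier → Set (c ⊔ ℓ)
  HasRoot l x = ∃ λ y → y ↑ l ≈ x

  hasRoot-isSubgroup : ∀ l → IsSubgroup (HasRoot l)
  hasRoot-isSubgroup l = record
    { resp      = λ { x≈y (z , zˡ≈x) → z , trans zˡ≈x x≈y }
    ; ε∈        = ε , ε↑ l
    ; ∙-closed  = λ { (u , uˡ≈x) (v , vˡ≈y) → u ∙ v , trans (↑-distrib-∙ u v l) (∙-cong uˡ≈x vˡ≈y) }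
    ; ⁻¹-closed = λ { (u , uˡ≈x) → u ⁻¹ , trans (⁻¹-↑ u l) (⁻¹-cong uˡ≈x) }
    }

  hasRoot-of-torsion : ∀ {l n} → Coprime l n → ∀ {x} → x ↑ n ≈ ε → HasRoot l x
  hasRoot-of-torsion {l} l⊥n {x} xⁿ≈ε = coprime-powers-generate (hasRoot-isSubgroup l) l⊥n
    (x , ≈-refl) (resp (sym xⁿ≈ε) ε∈)
    where open IsSubgroup (hasRoot-isSubgroup l)

  hasRoot-of-power : ∀ {m l} → Coprime m l → ∀ {x} → HasRoot l (x ↑ m) → HasRoot l x
  hasRoot-of-power {m} {l} m⊥l {x} root = coprime-powers-generate (hasRoot-isSubgroup l) m⊥l root (x , ≈-refl)

  order-divides : ∀ {g k} n → HasOrder G g k → g ↑ n ≈ ε → k ∣ n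
  order-divides {g} {k} n (0<k , gᵏ≈ε , minimal) gⁿ≈ε = m%n≡0⇒n∣m n k remainder≡0
    where
    instance
      k-nonZero : NonZero k
      k-nonZero = >-nonZero 0<k
    remainder≡0 : n % k ≡ 0
    remainder≡0 with n % k ≟ 0
    ... | yes r≡0 = r≡0
    ... | no  r≢0 = contradiction (trans (sym (↑-mod g k n gᵏ≈ε)) gⁿ≈ε)
                      (minimal (n % k) (n≢0⇒n>0 r≢0) (m%n<n n k))

  hasOrder-↑ : ∀ {g} x y → HasOrder G g (x * y) → HasOrder G (g ↑ x) y
  hasOrder-↑ {g} x y (0<xy , g^xy≈ε , minimal) =
      >-nonZero⁻¹ y {{m*n≢0⇒n≢0 x}}
    , trans (sym (↑-assoc g x y)) g^xy≈ε
    , λ j 0<j j<y gˣʲ≈ε → minimal (x * j) (>-nonZero⁻¹ (x * j) {{m*n≢0 x j {{x-nonZero}} {{>-nonZero 0<j}}}})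
                                     (*-monoʳ-< x j<y) (trans (↑-assoc g x j) gˣʲ≈ε)
    where
    instance
      xy-nonZero : NonZero (x * y)
      xy-nonZero = >-nonZero 0<xy
      x-nonZero : NonZero x
      x-nonZero = m*n≢0⇒m≢0 x

module Finite {c ℓ : Level} (G : AbelianGroup c ℓ) (F : IsFinite G) where

  open AbelianGroup G renaming (refl to ≈-refl)
  open IsFinite F
  open Powers G
  open import Algebra.Properties.Group group using (∙-cancelˡ; x∙y⁻¹≈ε⇒x≈y)
  open import Relation.Binary.Reasoning.Setoid setoid

  index : Carrier → Fin size
  index x = proj₁ (enum-surj x)

  enum-index : ∀ x → enum (index x) ≈ x
  enum-index x = proj₂ (enum-surj x)

  annihilator : ∀ g → ∃ λ d → 0 < d × d ≤ size × g ↑ d ≈ ε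
  annihilator g with Fin.pigeonhole (n<1+n size) (λ i → index (g ↑ toℕ i))
  ... | i , j , i<j , same-index = d , m<n⇒0<n∸m i<j , d≤size , gᵈ≈ε
    where
    d : ℕ
    d = toℕ j ∸ toℕ i
    d≤size : d ≤ size
    d≤size = ≤-trans (m∸n≤m (toℕ j) (toℕ i)) (Fin.toℕ≤pred[n] j)
    gᵈ≈ε : g ↑ d ≈ ε
    gᵈ≈ε = ∙-cancelˡ (g ↑ toℕ i) (g ↑ d) ε (begin
      g ↑ toℕ i ∙ g ↑ d   ≈⟨ ↑-homo-+ g (toℕ i) d ⟨
      g ↑ (toℕ i + d)     ≡⟨ ≡.cong (g ↑_) (m+[n∸m]≡n (<⇒≤ i<j)) ⟩
      g ↑ toℕ j           ≈⟨ enum-index _ ⟨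
      enum (index (g ↑ toℕ j)) ≡⟨ ≡.cong enum same-index ⟨
      enum (index (g ↑ toℕ i)) ≈⟨ enum-index _ ⟩
      g ↑ toℕ i           ≈⟨ identityʳ _ ⟨
      g ↑ toℕ i ∙ ε       ∎)

  order : ∀ g → ∃ λ k → HasOrder G g k × k ≤ size
  order g with annihilator g
  ... | suc d , _ , d<size , gᵈ≈ε with least (λ n → (g ↑ suc n) ≈? ε) gᵈ≈ε
  ...   | k , gᵏ≈ε , k≤d , below =
    suc k , (z<s , gᵏ≈ε , λ { (suc j) _ (s<s j<k) → below j<k }) , ≤-trans (s≤s k≤d) d<size

  module _ {p q} {P : Pred Carrier p} {Q : Pred Carrier q}
           (P-resp : P Respects _≈_) (Q-resp : Q Respects _≈_) (P? : Decidable P) (Q? : Decidable Q) where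

    ⊆-or-counterexample : (∀ x → P x → Q x) ⊎ ∃ λ x → P x × ¬ Q x
    ⊆-or-counterexample with Fin.all? (λ i → P? (enum i) →-dec Q? (enum i))
    ... | yes P⊆Q = inj₁ λ x Px → Q-resp (enum-index x) (P⊆Q (index x) (P-resp (sym (enum-index x)) Px))
    ... | no ¬P⊆Q with Fin.¬∀⟶∃¬ size _ (λ i → P? (enum i) →-dec Q? (enum i)) ¬P⊆Q
    ...   | i , ¬[P→Q] with P? (enum i) | Q? (enum i)
    ...     | _      | yes Qi = contradiction (λ _ → Qi) ¬[P→Q]
    ...     | no ¬Pi | _      = contradiction (λ Pi → contradiction Pi ¬Pi) ¬[P→Q]
    ...     | yes Pi | no ¬Qi = inj₂ (enum i , Pi , ¬Qi)

    ⊆? : Dec (∀ x → P x → Q x)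
    ⊆? with ⊆-or-counterexample
    ... | inj₁ P⊆Q = yes P⊆Q
    ... | inj₂ (x , Px , ¬Qx) = no λ P⊆Q → ¬Qx (P⊆Q x Px)

  hasRoot? : ∀ l x → Dec (HasRoot l x)
  hasRoot? l x = Dec.map′ (λ (i , iˡ≈x) → enum i , iˡ≈x)
                          (λ (y , yˡ≈x) → index y , trans (↑-congˡ l (enum-index y)) yˡ≈x)
                          (Fin.any? (λ i → (enum i ↑ l) ≈? x))

  roots>0 : ∀ {l x} → HasRoot l x → 0 < roots G F l x
  roots>0 {l} (y , yˡ≈x) = count>0 _ {index y} (trans (↑-congˡ l (enum-index y)) yˡ≈x)

  roots>0⇒hasRoot : ∀ {l x} → 0 < roots G F l x → HasRoot l x
  roots>0⇒hasRoot 0<roots with count>0⇒∃ _ 0<roots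
  ... | i , iˡ≈x = enum i , iˡ≈x

  roots≡0 : ∀ {l x} → ¬ HasRoot l x → roots G F l x ≡ 0
  roots≡0 ¬root = count≡0 _ λ i iˡ≈x → ¬root (enum i , iˡ≈x)

  translation : Carrier → Permutation′ size
  translation y = permutation (λ i → index (enum i ∙ y)) (λ i → index (enum i ∙ y ⁻¹))
    (λ i → enum-inj _ _ (cancel (enum-index _) (inverseˡ y)))
    (λ i → enum-inj _ _ (cancel (enum-index _) (inverseʳ y)))
    where
    cancel : ∀ {x u v w} → x ≈ u ∙ v → v ∙ w ≈ ε → enum (index (x ∙ w)) ≈ u
    cancel {x} {u} {v} {w} x≈uv vw≈ε = begin
      enum (index (x ∙ w))  ≈⟨ enum-index _ ⟩
      x ∙ w                 ≈⟨ ∙-congʳ x≈uv ⟩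
      (u ∙ v) ∙ w           ≈⟨ assoc u v w ⟩
      u ∙ (v ∙ w)           ≈⟨ ∙-congˡ vw≈ε ⟩
      u ∙ ε                 ≈⟨ identityʳ u ⟩
      u                     ∎

  roots-of-power : ∀ {l x} → HasRoot l x → roots G F l x ≡ roots G F l ε
  roots-of-power {l} {x} (y , yˡ≈x) = count-permute _ _ (translation (y ⁻¹)) λ i → mk⇔
    (λ iˡ≈x → trans (shifted i) (trans (∙-congʳ iˡ≈x) (inverseʳ x)))
    (λ shifted≈ε → x∙y⁻¹≈ε⇒x≈y _ _ (trans (sym (shifted i)) shifted≈ε))
    where
    shifted : ∀ i → enum (translation (y ⁻¹) ⟨$⟩ʳ i) ↑ l ≈ enum i ↑ l ∙ x ⁻¹
    shifted i = begin
      enum (index (enum i ∙ y ⁻¹)) ↑ l   ≈⟨ ↑-congˡ l (enum-index _) ⟩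
      (enum i ∙ y ⁻¹) ↑ l                ≈⟨ ↑-distrib-∙ _ _ l ⟩
      enum i ↑ l ∙ (y ⁻¹) ↑ l            ≈⟨ ∙-congˡ (⁻¹-↑ y l) ⟩
      enum i ↑ l ∙ (y ↑ l) ⁻¹            ≈⟨ ∙-congˡ (⁻¹-cong yˡ≈x) ⟩
      enum i ↑ l ∙ x ⁻¹                  ∎

module Span {c ℓ : Level} (G : AbelianGroup c ℓ) {q : ℕ} .{{_ : NonZero q}}
            {r : ℕ} (g : Fin r → AbelianGroup.Carrier G)
            (g-ann : ∀ i → AbelianGroup._≈_ G (pow G (g i) q) (AbelianGroup.ε G)) where

  open AbelianGroup G renaming (refl to ≈-refl)
  open Powers G
  open import Relation.Binary.Reasoning.Setoid setoid
  open import Algebra.Properties.Group group using (inverseʳ-unique)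

  combination : (Fin r → Fin q) → Carrier
  combination cs = prodFin G r (λ i → g i ↑ toℕ (cs i))

  InSpan : Carrier → Set ℓ
  InSpan x = ∃ λ cs → combination cs ≈ x

  Independent : Set ℓ
  Independent = ∀ cs ds → combination cs ≈ combination ds → ∀ i → cs i ≡ ds i

  ↑-mod-q : ∀ i n → g i ↑ toℕ (n mod q) ≈ g i ↑ n
  ↑-mod-q i n = trans (reflexive (≡.cong (g i ↑_) (Fin.toℕ-fromℕ< (m%n<n n q))))
                      (sym (↑-mod (g i) q n (g-ann i)))

  combination-mod : ∀ (ns : Fin r → ℕ) → combination (λ i → ns i mod q) ≈ prodFin G r (λ i → g i ↑ ns i)
  combination-mod ns = prodFin-cong r (λ i → ↑-mod-q i (ns i))

  combination-ann : ∀ cs → combination cs ↑ q ≈ ε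
  combination-ann cs = trans (prodFin-↑ r _ q) (prodFin-ε r λ i → begin
    (g i ↑ toℕ (cs i)) ↑ q   ≈⟨ ↑-comm (g i) q (toℕ (cs i)) ⟨
    g i ↑ (q * toℕ (cs i))   ≈⟨ ↑-annihilates-multiple (g i) {q} _ (m∣m*n (toℕ (cs i))) (g-ann i) ⟩
    ε                        ∎)

  inSpan-ann : ∀ {x} → InSpan x → x ↑ q ≈ ε
  inSpan-ann (cs , cs≈x) = trans (↑-congˡ q (sym cs≈x)) (combination-ann cs)

  inSpan-↑ : ∀ {x} n → InSpan x → InSpan (x ↑ n)
  inSpan-↑ {x} n (cs , cs≈x) = (λ i → toℕ (cs i) * n mod q) , (begin
    combination (λ i → toℕ (cs i) * n mod q)   ≈⟨ combination-mod _ ⟩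
    prodFin G r (λ i → g i ↑ (toℕ (cs i) * n))  ≈⟨ prodFin-cong r (λ i → ↑-assoc (g i) (toℕ (cs i)) n) ⟩
    prodFin G r (λ i → (g i ↑ toℕ (cs i)) ↑ n)  ≈⟨ prodFin-↑ r _ n ⟨
    combination cs ↑ n                           ≈⟨ ↑-congˡ n cs≈x ⟩
    x ↑ n                                        ∎)

  combination-0 : combination (λ _ → 0 mod q) ≈ ε
  combination-0 = trans (combination-mod (λ _ → 0)) (prodFin-ε r λ _ → ≈-refl)

  inSpan-resp : ∀ {x y} → x ≈ y → InSpan x → InSpan y
  inSpan-resp x≈y (cs , cs≈x) = cs , trans cs≈x x≈y

  inSpan-isSubgroup : IsSubgroup InSpan
  inSpan-isSubgroup = record
    { resp      = inSpan-resp
    ; ε∈        = (λ _ → 0 mod q) , combination-0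
    ; ∙-closed  = λ { {x} {y} (cs , cs≈x) (ds , ds≈y) → (λ i → (toℕ (cs i) + toℕ (ds i)) mod q) , (begin
        combination (λ i → (toℕ (cs i) + toℕ (ds i)) mod q)      ≈⟨ combination-mod _ ⟩
        prodFin G r (λ i → g i ↑ (toℕ (cs i) + toℕ (ds i)))
          ≈⟨ prodFin-cong r (λ i → ↑-homo-+ (g i) (toℕ (cs i)) (toℕ (ds i))) ⟩
        prodFin G r (λ i → g i ↑ toℕ (cs i) ∙ g i ↑ toℕ (ds i))  ≈⟨ prodFin-∙ r _ _ ⟩
        combination cs ∙ combination ds                          ≈⟨ ∙-cong cs≈x ds≈y ⟩
        x ∙ y                                                    ∎) }
    ; ⁻¹-closed = λ x∈ → inSpan-resp (↑-pred-q≈⁻¹ x∈) (inSpan-↑ (q ∸ 1) x∈)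
    }
    where
    ↑-pred-q≈⁻¹ : ∀ {x} → InSpan x → x ↑ (q ∸ 1) ≈ x ⁻¹
    ↑-pred-q≈⁻¹ {x} x∈ = inverseʳ-unique x _ (begin
      x ∙ x ↑ (q ∸ 1)   ≡⟨⟩
      x ↑ suc (q ∸ 1)   ≡⟨ ≡.cong (x ↑_) (m+[n∸m]≡n {1} {q} (>-nonZero⁻¹ q)) ⟩
      x ↑ q             ≈⟨ inSpan-ann x∈ ⟩
      ε                 ∎)

  inSpan? : (∀ x y → Dec (x ≈ y)) → ∀ x → Dec (InSpan x)
  inSpan? _≟_ x = ∃-Fin→? r q
    (λ cs≗ds cs≈x → trans (prodFin-cong r λ i → reflexive (≡.cong (λ c → g i ↑ toℕ c) (≡.sym (cs≗ds i)))) cs≈x)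
    (λ cs → combination cs ≟ x)

module PrimePowerSpan {c ℓ : Level} (G : AbelianGroup c ℓ) {p : ℕ} (p-prime : Prime p) (e : ℕ)
                      {r : ℕ} (g : Fin r → AbelianGroup.Carrier G)
                      (g-ann : ∀ i → AbelianGroup._≈_ G (pow G (g i) (p ^ suc e)) (AbelianGroup.ε G)) where

  open AbelianGroup G renaming (refl to ≈-refl)
  open Powers G
  open PrimePowers p-prime
  private instance
    q-nonZero : NonZero (p ^ suc e)
    q-nonZero = p^-nonZero (suc e)
  open Span G g g-ann public
  open import Relation.Binary.Reasoning.Setoid setoid

  -- Independence forces every exponent of an element killed by p ^ e to be divisible by p.
  root-in-span : Independent → ∀ {x} → InSpan x → x ↑ p ^ e ≈ ε → ∃ λ y → InSpan y × y ↑ p ≈ x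
  root-in-span independent {x} (cs , cs≈x) xᵖᵉ≈ε = combination ds , (ds , ≈-refl) , (begin
    combination ds ↑ p                           ≈⟨ prodFin-↑ r _ p ⟩
    prodFin G r (λ i → (g i ↑ toℕ (ds i)) ↑ p)   ≈⟨ prodFin-cong r factor-root ⟩
    combination cs                               ≈⟨ cs≈x ⟩
    x                                            ∎)
    where
    q : ℕ
    q = p ^ suc e

    cs·pᵉ ds : Fin r → Fin q
    cs·pᵉ i = toℕ (cs i) * p ^ e mod q
    ds i = toℕ (cs i) / p mod q

    killed : combination cs·pᵉ ≈ combination (λ _ → 0 mod q)
    killed = begin
      combination cs·pᵉ                               ≈⟨ combination-mod _ ⟩
      prodFin G r (λ i → g i ↑ (toℕ (cs i) * p ^ e))  ≈⟨ prodFin-cong r factor-↑ ⟩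
      prodFin G r (λ i → (g i ↑ toℕ (cs i)) ↑ p ^ e)  ≈⟨ prodFin-↑ r _ (p ^ e) ⟨
      combination cs ↑ p ^ e                          ≈⟨ ↑-congˡ (p ^ e) cs≈x ⟩
      x ↑ p ^ e                                       ≈⟨ xᵖᵉ≈ε ⟩
      ε                                               ≈⟨ combination-0 ⟨
      combination (λ _ → 0 mod q)                     ∎

      where
      factor-↑ : ∀ i → g i ↑ (toℕ (cs i) * p ^ e) ≈ (g i ↑ toℕ (cs i)) ↑ p ^ e
      factor-↑ i = ↑-assoc (g i) (toℕ (cs i)) (p ^ e)

    p∣cs : ∀ i → p ∣ toℕ (cs i)
    p∣cs i = p^suc∣⇒p∣ e (toℕ (cs i)) (mod≡0⇒∣ _ q (independent cs·pᵉ (λ _ → 0 mod q) killed i))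

    factor-root : ∀ i → (g i ↑ toℕ (ds i)) ↑ p ≈ g i ↑ toℕ (cs i)
    factor-root i = begin
      (g i ↑ toℕ (ds i)) ↑ p         ≈⟨ ↑-congˡ p (↑-mod-q i (toℕ (cs i) / p)) ⟩
      (g i ↑ (toℕ (cs i) / p)) ↑ p   ≈⟨ ↑-assoc (g i) (toℕ (cs i) / p) p ⟨
      g i ↑ (toℕ (cs i) / p * p)     ≡⟨ ≡.cong (g i ↑_) (m/n*n≡m (p∣cs i)) ⟩
      g i ↑ toℕ (cs i)               ∎

module Sylow {c ℓ : Level} (G : AbelianGroup c ℓ) (F : IsFinite G) {p : ℕ} (p-prime : Prime p) where

  open AbelianGroup G renaming (refl to ≈-refl)
  open IsFinite F
  open Powers G
  open Finite G F
  open PrimePowers p-prime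

  p-torsion-order : ∀ {x} e → x ↑ p ^ e ≈ ε → ∃ λ j → j ≤ e × HasOrder G x (p ^ j)
  p-torsion-order {x} e xᵖᵉ≈ε with order x
  ... | k , ord , _ with ∣p^⇒≡p^ e (order-divides (p ^ e) ord xᵖᵉ≈ε)
  ...   | j , j≤e , refl = j , j≤e , ord

  hasOrder-p^suc : ∀ {x} e → x ↑ p ^ suc e ≈ ε → ¬ x ↑ p ^ e ≈ ε → HasOrder G x (p ^ suc e)
  hasOrder-p^suc {x} e ann ¬ann with p-torsion-order (suc e) ann
  ... | j , j≤1+e , ord with m≤n⇒m<n∨m≡n j≤1+e
  ...   | inj₂ refl      = ord
  ...   | inj₁ (s≤s j≤e) =
    contradiction (↑-annihilates-multiple x (p ^ e) (^-monoʳ-∣ p j≤e) (order-ann ord)) ¬ann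

  inSylow⇒↑p^size : ∀ {x} → InSylow G p x → x ↑ p ^ size ≈ ε
  inSylow⇒↑p^size {x} (m , xᵖᵐ≈ε) with order x
  ... | k , ord , k≤size with ∣p^⇒≡p^ m (order-divides (p ^ m) ord xᵖᵐ≈ε)
  ...   | j , _ , refl = ↑-annihilates-multiple x (p ^ size)
                           (^-monoʳ-∣ p (<⇒≤ (<-≤-trans (n<m^n 1<p j) k≤size))) (order-ann ord)

  inSylow? : ∀ x → Dec (InSylow G p x)
  inSylow? x = Dec.map′ (size ,_) inSylow⇒↑p^size ((x ↑ p ^ size) ≈? ε)

  inSylow-resp : InSylow G p Respects _≈_
  inSylow-resp x≈y (m , xᵖᵐ≈ε) = m , trans (↑-congˡ (p ^ m) (sym x≈y)) xᵖᵐ≈ε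

  AnnihilatesSylow : ℕ → Set (c ⊔ ℓ)
  AnnihilatesSylow j = ∀ x → InSylow G p x → x ↑ p ^ j ≈ ε

  annihilatesSylow? : ∀ j → Dec (AnnihilatesSylow j)
  annihilatesSylow? j = ⊆? inSylow-resp (annihilated-resp (p ^ j)) inSylow? (λ x → (x ↑ p ^ j) ≈? ε)

  sylow-exponent : AnnihilatesSylow 0 ⊎ ∃ λ e → AnnihilatesSylow (suc e) × ∃ λ g → HasOrder G g (p ^ suc e)
  sylow-exponent with annihilatesSylow? 0
  ... | yes ann₀ = inj₁ ann₀
  ... | no ¬ann₀ with crossing annihilatesSylow? ¬ann₀ {size} (λ x → inSylow⇒↑p^size)
  ...   | e , ¬annₑ , ann₁₊ₑ
    with ⊆-or-counterexample inSylow-resp (annihilated-resp (p ^ e)) inSylow? (λ x → (x ↑ p ^ e) ≈? ε)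
  ...     | inj₁ annₑ               = contradiction annₑ ¬annₑ
  ...     | inj₂ (g , g∈S , ¬gᵖᵉ≈ε) = inj₂ (e , ann₁₊ₑ , g , hasOrder-p^suc e (ann₁₊ₑ g g∈S) ¬gᵖᵉ≈ε)

module HomocyclicSylow {c ℓ : Level} (G : AbelianGroup c ℓ) (F : IsFinite G) {p : ℕ} (p-prime : Prime p) where

  open AbelianGroup G renaming (refl to ≈-refl)
  open Powers G
  open Finite G F
  open PrimePowers p-prime
  open import Relation.Binary.Reasoning.Setoid setoid

  -- An element of order p ^ (k + 1) forces k < e, so v is killed by p ^ (e - 1) and has a root in the span.
  homocyclic-root : SylowHomocyclic G p → ∀ {u k} → u ↑ p ^ suc k ≈ ε → ¬ u ↑ p ^ k ≈ ε →
                    ∀ {v} → v ↑ p ^ k ≈ ε → HasRoot p v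
  homocyclic-root (e , r , g , orders , spanning , independent) {u} {k} uᵖ¹⁺ᵏ≈ε ¬uᵖᵏ≈ε {v} vᵖᵏ≈ε with k <? e
  ... | no k≮e = contradiction
        (↑-annihilates-multiple u (p ^ k) (^-monoʳ-∣ p (≮⇒≥ k≮e)) (inSpan-ann (spanning u (suc k , uᵖ¹⁺ᵏ≈ε))))
        ¬uᵖᵏ≈ε
    where open Span G {{p^-nonZero e}} g (λ i → order-ann (orders i))
  ... | yes (s≤s {n = e′} k≤e′) with root-in-span independent (spanning v (k , vᵖᵏ≈ε))
                                       (↑-annihilates-multiple v (p ^ e′) (^-monoʳ-∣ p k≤e′) vᵖᵏ≈ε)
    where open PrimePowerSpan G p-prime e′ g (λ i → order-ann (orders i))
  ...   | y , _ , yᵖ≈v = y , yᵖ≈v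

  root-of-same-order : SylowHomocyclic G p → ∀ {a b n} → HasOrder G a n → HasOrder G b n →
                       HasRoot p b → HasRoot p a
  root-of-same-order H {a} {b} {n} (0<n , aⁿ≈ε , _) (_ , bⁿ≈ε , b-minimal) (c , cᵖ≈b) with p-part n 0<n
  ... | zero , m , refl , p∤m = hasRoot-of-power (∤⇒coprime p∤m)
          (ε , trans (ε↑ p) (sym (trans (reflexive (≡.cong (a ↑_) (≡.sym (*-identityˡ m)))) aⁿ≈ε)))
  ... | suc k , m , refl , p∤m = hasRoot-of-power (∤⇒coprime p∤m)
          (homocyclic-root H {c ↑ m} {suc k} cᵐ-ann ¬cᵐ-ann {a ↑ m} aᵐ-ann)
    where
    A j : ℕ
    A = p ^ k
    j = A * m

    instance
      m-nonZero : NonZero m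
      m-nonZero = m*n≢0⇒n≢0 (p * A) {{>-nonZero 0<n}}
      j-nonZero : NonZero j
      j-nonZero = m*n≢0 A m {{p^-nonZero k}}

    shuffle₁ : ∀ p A m → m * (p * (p * A)) ≡ p * (p * A * m)
    shuffle₁ = solve-∀
    shuffle₂ : ∀ p A m → p * (A * m) ≡ m * (p * A)
    shuffle₂ = solve-∀
    shuffle₃ : ∀ p A m → A * m * p ≡ p * A * m
    shuffle₃ = solve-∀

    c↑p* : ∀ t → c ↑ (p * t) ≈ b ↑ t
    c↑p* t = trans (↑-assoc c p t) (↑-congˡ t cᵖ≈b)

    cᵐ-ann : (c ↑ m) ↑ p ^ suc (suc k) ≈ ε
    cᵐ-ann = begin
      (c ↑ m) ↑ (p * (p * A))  ≈⟨ ↑-assoc c m _ ⟨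
      c ↑ (m * (p * (p * A)))  ≡⟨ ≡.cong (c ↑_) (shuffle₁ p A m) ⟩
      c ↑ (p * (p * A * m))    ≈⟨ c↑p* _ ⟩
      b ↑ (p * A * m)          ≈⟨ bⁿ≈ε ⟩
      ε                        ∎

    ¬cᵐ-ann : ¬ (c ↑ m) ↑ p ^ suc k ≈ ε
    ¬cᵐ-ann cᵐᵖᵏ≈ε = b-minimal j (>-nonZero⁻¹ j) (≡.subst (j <_) (shuffle₃ p A m) (m<m*n j p 1<p)) (begin
      b ↑ j                ≈⟨ c↑p* j ⟨
      c ↑ (p * (A * m))    ≡⟨ ≡.cong (c ↑_) (shuffle₂ p A m) ⟩
      c ↑ (m * (p * A))    ≈⟨ ↑-assoc c m _ ⟩
      (c ↑ m) ↑ (p * A)    ≈⟨ cᵐᵖᵏ≈ε ⟩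
      ε                    ∎)

    aᵐ-ann : (a ↑ m) ↑ p ^ suc k ≈ ε
    aᵐ-ann = trans (sym (↑-assoc a m _)) (trans (reflexive (≡.cong (a ↑_) (*-comm m (p * A)))) aⁿ≈ε)

  homocyclic⇒¬propertyP : SylowHomocyclic G p → ¬ PropertyP G F p
  homocyclic⇒¬propertyP H (a , b , (_ , ord-a , ord-b) , roots-a≡0 , roots-b>0 , _) =
    >⇒≢ (roots>0 {p} (root-of-same-order H ord-a ord-b (roots>0⇒hasRoot {p} roots-b>0))) roots-a≡0

module Extension {c ℓ : Level} (G : AbelianGroup c ℓ) {q : ℕ} .{{_ : NonZero q}}
                 {r : ℕ} (g : Fin r → AbelianGroup.Carrier G)
                 (g-ann : ∀ i → AbelianGroup._≈_ G (pow G (g i) q) (AbelianGroup.ε G))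
                 (w : AbelianGroup.Carrier G) (w-ann : AbelianGroup._≈_ G (pow G w q) (AbelianGroup.ε G)) where

  open AbelianGroup G renaming (refl to ≈-refl)
  open Powers G
  open import Relation.Binary.Reasoning.Setoid setoid
  open import Algebra.Properties.Group group using (∙-cancelˡ; x≈z//y)

  module Old = Span G g g-ann
  cons-ann : ∀ i → cons w g i ↑ q ≈ ε
  cons-ann Fin.zero    = w-ann
  cons-ann (Fin.suc i) = g-ann i

  module New = Span G (cons w g) cons-ann
  open IsSubgroup Old.inSpan-isSubgroup

  AvoidsSpan : Set ℓ
  AvoidsSpan = ∀ δ → 0 < δ → δ < q → ¬ Old.InSpan (w ↑ δ)

  inSpan-extend : ∀ {x} → Old.InSpan x → New.InSpan x
  inSpan-extend (cs , cs≈x) =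
    cons (0 mod q) cs , trans (∙-congʳ (New.↑-mod-q Fin.zero 0)) (trans (identityˡ _) cs≈x)

  inSpan-new : New.InSpan w
  inSpan-new = cons (1 mod q) (λ _ → 0 mod q) , (begin
    w ↑ toℕ (1 mod q) ∙ Old.combination (λ _ → 0 mod q)  ≈⟨ ∙-cong (New.↑-mod-q Fin.zero 1) Old.combination-0 ⟩
    w ↑ 1 ∙ ε                                           ≈⟨ identityʳ _ ⟩
    w ↑ 1                                               ≈⟨ ↑-identity w ⟩
    w                                                   ∎)

  module _ (avoids : AvoidsSpan) where

    no-collision : ∀ {c d A B} → c < d → d < q → Old.InSpan A → Old.InSpan B → ¬ w ↑ c ∙ A ≈ w ↑ d ∙ B
    no-collision {c} {d} {A} {B} c<d d<q A∈ B∈ collision =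
      avoids (d ∸ c) (m<n⇒0<n∸m c<d) (≤-<-trans (m∸n≤m d c) d<q) (resp (sym wᵈ⁻ᶜ≈A/B) (//-closed A∈ B∈))
      where
      wᵈ⁻ᶜ≈A/B : w ↑ (d ∸ c) ≈ A ∙ B ⁻¹
      wᵈ⁻ᶜ≈A/B = x≈z//y _ B A (sym (∙-cancelˡ (w ↑ c) A _ (begin
        w ↑ c ∙ A                     ≈⟨ collision ⟩
        w ↑ d ∙ B                     ≡⟨ ≡.cong (λ k → w ↑ k ∙ B) (m+[n∸m]≡n (<⇒≤ c<d)) ⟨
        w ↑ (c + (d ∸ c)) ∙ B         ≈⟨ ∙-congʳ (↑-homo-+ w c (d ∸ c)) ⟩
        (w ↑ c ∙ w ↑ (d ∸ c)) ∙ B     ≈⟨ assoc _ _ _ ⟩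
        w ↑ c ∙ (w ↑ (d ∸ c) ∙ B)     ∎)))

    cons-independent : Old.Independent → New.Independent
    cons-independent independent cs ds same = λ
      { Fin.zero    → Fin.toℕ-injective c₀≡d₀
      ; (Fin.suc i) → independent (tail cs) (tail ds) tails-agree i
      }
      where
      c₀ d₀ : ℕ
      c₀ = toℕ (head cs)
      d₀ = toℕ (head ds)
      tail-cs∈ : Old.InSpan (Old.combination (tail cs))
      tail-cs∈ = tail cs , ≈-refl
      tail-ds∈ : Old.InSpan (Old.combination (tail ds))
      tail-ds∈ = tail ds , ≈-refl
      c₀≡d₀ : c₀ ≡ d₀
      c₀≡d₀ with <-cmp c₀ d₀
      ... | tri< c₀<d₀ _ _ = contradiction same (no-collision c₀<d₀ (Fin.toℕ<n _) tail-cs∈ tail-ds∈)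
      ... | tri≈ _ c₀≡d₀ _ = c₀≡d₀
      ... | tri> _ _ d₀<c₀ = contradiction (sym same) (no-collision d₀<c₀ (Fin.toℕ<n _) tail-ds∈ tail-cs∈)
      tails-agree : Old.combination (tail cs) ≈ Old.combination (tail ds)
      tails-agree = ∙-cancelˡ (w ↑ c₀) _ _ (trans same (∙-congʳ (reflexive (≡.cong (w ↑_) (≡.sym c₀≡d₀)))))

module Enlarge {c ℓ : Level} (G : AbelianGroup c ℓ) (F : IsFinite G) {p : ℕ} (p-prime : Prime p) (e : ℕ)
               (roots : ∀ x → AbelianGroup._≈_ G (pow G x (p ^ e)) (AbelianGroup.ε G) → Powers.HasRoot G p x)
               {r : ℕ} (g : Fin r → AbelianGroup.Carrier G)
               (g-ann : ∀ i → AbelianGroup._≈_ G (pow G (g i) (p ^ suc e)) (AbelianGroup.ε G)) where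

  open AbelianGroup G renaming (refl to ≈-refl)
  open IsFinite F
  open Powers G
  open PrimePowers p-prime
  open Sylow G F p-prime using (hasOrder-p^suc)
  open PrimePowerSpan G p-prime e g g-ann
  open IsSubgroup inSpan-isSubgroup
  open import Relation.Binary.Reasoning.Setoid setoid
  open import Algebra.Properties.Group group using (//-rightDividesˡ; x≈y⇒x∙y⁻¹≈ε)
  private instance
    q-nonZero : NonZero (p ^ suc e)
    q-nonZero = p^-nonZero (suc e)

  p^t-root : ∀ {z} → z ↑ p ≈ ε → ∀ t → t ≤ e → ∃ λ w → w ↑ p ^ t ≈ z
  p^t-root {z} _ zero _ = z , ↑-identity z
  p^t-root {z} zᵖ≈ε (suc t) t<e with p^t-root zᵖ≈ε t (<⇒≤ t<e)
  ... | w , wᵖᵗ≈z with roots w (↑-annihilates-multiple w (p ^ e) (^-monoʳ-∣ p t<e) (begin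
          w ↑ (p * p ^ t)   ≈⟨ ↑-comm w p (p ^ t) ⟩
          (w ↑ p ^ t) ↑ p   ≈⟨ ↑-congˡ p wᵖᵗ≈z ⟩
          z ↑ p             ≈⟨ zᵖ≈ε ⟩
          ε                 ∎))
  ...   | u , uᵖ≈w = u , (begin
          u ↑ (p * p ^ t)   ≈⟨ ↑-assoc u p (p ^ t) ⟩
          (u ↑ p) ↑ p ^ t   ≈⟨ ↑-congˡ (p ^ t) uᵖ≈w ⟩
          w ↑ p ^ t         ≈⟨ wᵖᵗ≈z ⟩
          z                 ∎)

  module _ (independent : Independent) where

    -- Take the last power y = x ^ (p ^ k) outside the span; y ^ p = h ^ p inside it, and z = y / h.
    torsion-outside-span : ∀ {x} → x ↑ p ^ suc e ≈ ε → ¬ InSpan x → ∃ λ z → z ↑ p ≈ ε × ¬ InSpan z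
    torsion-outside-span {x} xᵠ≈ε x∉ with crossing (λ k → inSpan? _≈?_ (x ↑ p ^ k))
                                            (λ x¹∈ → x∉ (resp (↑-identity x) x¹∈)) {suc e} (resp (sym xᵠ≈ε) ε∈)
    ... | k , y∉ , yᵖ∈ with root-in-span independent (resp (↑-comm x p (p ^ k)) yᵖ∈)
                              (trans (sym (↑-assoc y p (p ^ e))) (annihilated-↑ x (p ^ k) {p ^ suc e} xᵠ≈ε))
      where
      y : Carrier
      y = x ↑ p ^ k
    ...   | h , h∈ , hᵖ≈yᵖ = y ∙ h ⁻¹ , zᵖ≈ε , λ z∈ → y∉ (resp (//-rightDividesˡ h y) (∙-closed z∈ h∈))
      where
      y : Carrier
      y = x ↑ p ^ k
      zᵖ≈ε : (y ∙ h ⁻¹) ↑ p ≈ ε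
      zᵖ≈ε = begin
        (y ∙ h ⁻¹) ↑ p          ≈⟨ ↑-distrib-∙ y (h ⁻¹) p ⟩
        y ↑ p ∙ (h ⁻¹) ↑ p      ≈⟨ ∙-congˡ (⁻¹-↑ h p) ⟩
        y ↑ p ∙ (h ↑ p) ⁻¹      ≈⟨ x≈y⇒x∙y⁻¹≈ε (sym hᵖ≈yᵖ) ⟩
        ε                       ∎

    -- If w ^ δ were in the span, so would be (w ^ (p ^ e)) ^ u = z ^ u with u the p'-part of δ, hence z.
    avoids-span : ∀ {z w} → z ↑ p ≈ ε → ¬ InSpan z → w ↑ p ^ e ≈ z →
                  ∀ δ → 0 < δ → δ < p ^ suc e → ¬ InSpan (w ↑ δ)
    avoids-span {z} {w} zᵖ≈ε z∉ wᵖᵉ≈z δ 0<δ δ<q wᵟ∈ with p-part δ 0<δ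
    ... | s , u , refl , p∤u = z∉ (coprime-powers-generate inSpan-isSubgroup (∤⇒coprime p∤u)
                                 (resp zᵘ≈ (↑-closed (p ^ (e ∸ s)) wᵟ∈)) (resp (sym zᵖ≈ε) ε∈))
      where
      zᵘ≈ : (w ↑ (p ^ s * u)) ↑ p ^ (e ∸ s) ≈ z ↑ u
      zᵘ≈ = begin
        (w ↑ (p ^ s * u)) ↑ p ^ (e ∸ s)   ≈⟨ ↑-assoc w (p ^ s * u) (p ^ (e ∸ s)) ⟨
        w ↑ (p ^ s * u * p ^ (e ∸ s))     ≡⟨ ≡.cong (w ↑_) (^-split p u (exponent-bound {s} {e} {u} 0<δ δ<q)) ⟩
        w ↑ (u * p ^ e)                   ≈⟨ ↑-comm w u (p ^ e) ⟩
        (w ↑ p ^ e) ↑ u                   ≈⟨ ↑-congˡ u wᵖᵉ≈z ⟩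
        z ↑ u                             ∎

    enlarge : ∀ {x} → x ↑ p ^ suc e ≈ ε → ¬ InSpan x →
              ∃ λ w → HasOrder G w (p ^ suc e) × ¬ InSpan w × (∀ δ → 0 < δ → δ < p ^ suc e → ¬ InSpan (w ↑ δ))
    enlarge xᵠ≈ε x∉ =
      let z , zᵖ≈ε , z∉ = torsion-outside-span xᵠ≈ε x∉
          w , wᵖᵉ≈z     = p^t-root zᵖ≈ε e ≤-refl
      in w , hasOrder-p^suc e (trans (↑-comm w p (p ^ e)) (trans (↑-congˡ p wᵖᵉ≈z) zᵖ≈ε))
                              (λ wᵖᵉ≈ε → z∉ (resp (trans (sym wᵖᵉ≈ε) wᵖᵉ≈z) ε∈))
           , (λ w∈ → z∉ (resp wᵖᵉ≈z (↑-closed (p ^ e) w∈)))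
           , avoids-span zᵖ≈ε z∉ wᵖᵉ≈z

module Basis {c ℓ : Level} (G : AbelianGroup c ℓ) (F : IsFinite G) {p : ℕ} (p-prime : Prime p) (e : ℕ)
             (roots : ∀ x → AbelianGroup._≈_ G (pow G x (p ^ e)) (AbelianGroup.ε G) → Powers.HasRoot G p x)
             (sylow-ann : Sylow.AnnihilatesSylow G F p-prime (suc e)) where

  open AbelianGroup G renaming (refl to ≈-refl)
  open IsFinite F
  open Powers G
  open Finite G F
  open PrimePowers p-prime
  open Sylow G F p-prime using (inSylow?; inSylow-resp)
  private instance
    q-nonZero : NonZero (p ^ suc e)
    q-nonZero = p^-nonZero (suc e)

  spanCount : ∀ {r} (g : Fin r → Carrier) → (∀ i → g i ↑ p ^ suc e ≈ ε) → ℕ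
  spanCount g g-ann = count (λ i → Span.inSpan? G g g-ann _≈?_ (enum i))

  -- Each round adds a basis element and strictly enlarges the span, so size + 1 rounds suffice.
  grow : ∀ fuel {r} (g : Fin r → Carrier) (orders : ∀ i → HasOrder G (g i) (p ^ suc e)) →
         Span.Independent G g (λ i → order-ann (orders i)) →
         size < spanCount g (λ i → order-ann (orders i)) + fuel → SylowHomocyclic G p
  grow zero g orders _ bound = contradiction (≤-trans (≤-reflexive (+-identityʳ _)) (count≤n _)) (<⇒≱ bound)
  grow (suc fuel) {r} g orders independent bound =
    finish-or-extend (⊆-or-counterexample inSylow-resp inSpan-resp inSylow? (inSpan? _≈?_))
    where
    g-ann : ∀ i → g i ↑ p ^ suc e ≈ ε
    g-ann i = order-ann (orders i)
    open Span G g g-ann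
    open Enlarge G F p-prime e roots g g-ann using (enlarge)

    finish-or-extend : (∀ x → InSylow G p x → InSpan x) ⊎ ∃ (λ x → InSylow G p x × ¬ InSpan x) →
                       SylowHomocyclic G p
    finish-or-extend (inj₁ sylow⊆span) = suc e , r , g , orders , sylow⊆span , independent
    finish-or-extend (inj₂ (x , x∈S , x∉)) =
      let w , w-order , w∉ , avoids = enlarge independent (sylow-ann x x∈S) x∉
          module E = Extension G g g-ann w (order-ann w-order)
      in grow fuel (cons w g) (cons-orders w-order) (E.cons-independent avoids independent)
           (<-≤-trans bound (≤-trans (≤-reflexive (+-suc _ fuel)) (+-monoˡ-≤ fuel
              (count-strictMono (λ i → inSpan? _≈?_ (enum i)) (λ i → E.New.inSpan? _≈?_ (enum i))
                                E.inSpan-extend {index w} (E.New.inSpan-resp (sym (enum-index w)) E.inSpan-new)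
                                (λ w∈ → w∉ (inSpan-resp (enum-index w) w∈))))))
      where
      cons-orders : ∀ {w} → HasOrder G w (p ^ suc e) → ∀ i → HasOrder G (cons w g i) (p ^ suc e)
      cons-orders w-order Fin.zero    = w-order
      cons-orders w-order (Fin.suc i) = orders i

  homocyclic : SylowHomocyclic G p
  homocyclic = grow (suc size) {0} (λ ()) (λ ()) (λ _ _ _ ()) (≤-trans (n<1+n size) (m≤n+m (suc size) _))

module NonHomocyclicSylow {c ℓ : Level} (G : AbelianGroup c ℓ) (F : IsFinite G) {p : ℕ} (p-prime : Prime p)
  where

  open AbelianGroup G renaming (refl to ≈-refl)
  open IsFinite F
  open Powers G
  open Finite G F
  open PrimePowers p-prime
  open Sylow G F p-prime
  open import Relation.Binary.Reasoning.Setoid setoid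

  p-torsion-hasRoot : ∀ {l} → 0 < l → l < p → ∀ {x j} → x ↑ p ^ j ≈ ε → HasRoot l x
  p-torsion-hasRoot 0<l l<p {j = j} =
    hasRoot-of-torsion (coprime-^ʳ (Coprime.sym (prime⇒coprime p-prime {{>-nonZero 0<l}} l<p)) j)

  propertyP-witnesses : ∀ {e a g₀} → HasOrder G g₀ (p ^ suc e) → a ↑ p ^ e ≈ ε → ¬ HasRoot p a → PropertyP G F p
  propertyP-witnesses {e} {a} {g₀} g₀-order aᵖᵉ≈ε ¬a-root with p-torsion-order e aᵖᵉ≈ε
  ... | j , j≤e , a-order =
    a , b , (p ^ j , a-order , b-order) , roots≡0 {p} ¬a-root , roots>0 {p} b-root , same-roots
    where
    b : Carrier
    b = g₀ ↑ p ^ suc (e ∸ j)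

    b-order : HasOrder G b (p ^ j)
    b-order = hasOrder-↑ (p ^ suc (e ∸ j)) (p ^ j) (≡.subst (HasOrder G g₀) exponent g₀-order)
      where
      exponent : p ^ suc e ≡ p ^ suc (e ∸ j) * p ^ j
      exponent = ≡.trans (≡.cong (λ k → p ^ suc k) (≡.sym (m∸n+n≡m j≤e))) (^-distribˡ-+-* p (suc (e ∸ j)) j)

    b-root : HasRoot p b
    b-root = g₀ ↑ p ^ (e ∸ j) , sym (↑-comm g₀ p (p ^ (e ∸ j)))

    same-roots : ∀ l → 1 < l → l < p → SquareFree l → roots G F l a ≡ roots G F l b
    same-roots l 1<l l<p _ =
      ≡.trans (roots-of-power {l} (p-torsion-hasRoot 0<l l<p {j = j} (order-ann a-order)))
              (≡.sym (roots-of-power {l} (p-torsion-hasRoot 0<l l<p {j = j} (order-ann b-order))))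
      where
      0<l : 0 < l
      0<l = <-trans z<s 1<l

  ¬homocyclic⇒propertyP : ¬ SylowHomocyclic G p → PropertyP G F p
  ¬homocyclic⇒propertyP ¬H with sylow-exponent
  ... | inj₁ sylow-trivial = contradiction (0 , 0 , (λ ()) , (λ ()) , trivial-basis , (λ _ _ _ ())) ¬H
    where
    trivial-basis : ∀ x → InSylow G p x → ∃ λ (cs : Fin 0 → Fin 1) → ε ≈ x
    trivial-basis x x∈S = (λ ()) , sym (trans (sym (↑-identity x)) (sylow-trivial x x∈S))
  ... | inj₂ (e , sylow-ann , g₀ , g₀-order)
    with ⊆-or-counterexample (annihilated-resp (p ^ e)) (IsSubgroup.resp (hasRoot-isSubgroup p))
                             (λ x → (x ↑ p ^ e) ≈? ε) (hasRoot? p)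
  ...   | inj₁ roots = contradiction (Basis.homocyclic G F p-prime e roots sylow-ann) ¬H
  ...   | inj₂ (a , aᵖᵉ≈ε , ¬a-root) = propertyP-witnesses {e} g₀-order aᵖᵉ≈ε ¬a-root

theorem3p17 : ∀ {c ℓ : Level} (G : AbelianGroup c ℓ) (F : IsFinite G) (p : ℕ) →
    Prime p → (PropertyP G F p ⇔ (¬ SylowHomocyclic G p))
theorem3p17 G F p p-prime = mk⇔
  (λ propertyP homocyclic → HomocyclicSylow.homocyclic⇒¬propertyP G F p-prime homocyclic propertyP)
  (NonHomocyclicSylow.¬homocyclic⇒propertyP G F p-prime)
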